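{- Let $N\ge 0$ be an integer and let $A,B$ be non-negative integers with $A+B=N$, $A\neq 0$ and $B\neq 0$ (so that neither $(A,B)$ nor $(B,A)$ is the root $(0,N)$). If $(A,B)$ is at depth $d$ in the CVT-XOR Tree with root $(0,N)$, then $(B,A)$ is also at depth $d$. (By contrast, the root $(0,N)$ is at depth $0$ while $(N,0)$ is at depth $1$.)
   Context: For non-negative integers $X,Y$ written in binary, $\mathrm{XOR}(X,Y)$ is their bitwise exclusive or, and $\mathrm{CVT}(X,Y)=2\cdot(X \mathbin{\mathrm{AND}} Y)$ (bitwise AND shifted one position left). Define $f(X,Y)=(\mathrm{CVT}(X,Y),\mathrm{XOR}(X,Y))$; $f$ preserves the sum $X+Y$, and for every pair of non-negative integers iterating $f$ eventually reaches $(0,X+Y)$, which is fixed by $f$. The CVT-XOR Tree with root $(0,N)$ has as nodes all pairs $(X,Y)$ of non-negative integers with $X+Y=N$, the parent of a non-root node $(X,Y)$ being $f(X,Y)$. The depth of a node $(X,Y)$ is the least $k\ge 0$ such that $f^k(X,Y)=(0,N)$. -}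

module Defs where

open import Data.Nat using (ℕ; zero; suc; _+_; _*_; _<_)
open import Data.Nat.DivMod using (_/_; _%_)
open import Data.Product using (_×_; _,_)
open import Relation.Binary.PropositionalEquality using (_≡_)
open import Relation.Nullary using (¬_)

-- The first argument is fuel:
-- each step halves both inputs, so fuel ≥ (number of bits) suffices;
-- we use fuel x + y + 1 (well above the bit length) below.
xorF : ℕ → ℕ → ℕ → ℕ
xorF zero    x y = 0
xorF (suc k) x y = ((x % 2 + y % 2) % 2) + 2 * xorF k (x / 2) (y / 2)

andF : ℕ → ℕ → ℕ → ℕ
andF zero    x y = 0
andF (suc k) x y = ((x % 2) * (y % 2)) + 2 * andF k (x / 2) (y / 2)

XOR : ℕ → ℕ → ℕ
XOR x y = xorF (suc (x + y)) x y

AND : ℕ → ℕ → ℕ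
AND x y = andF (suc (x + y)) x y

CVT : ℕ → ℕ → ℕ
CVT x y = 2 * AND x y

f : ℕ × ℕ → ℕ × ℕ
f (x , y) = (CVT x y , XOR x y)

iter : ℕ → ℕ × ℕ → ℕ × ℕ
iter zero    p = p
iter (suc k) p = f (iter k p)

-- (X,Y) is at depth d in the CVT-XOR tree with root (0, X+Y):
-- d is the least k with f^k(X,Y) = (0, X+Y).
IsDepth : ℕ → ℕ → ℕ → Set
IsDepth x y d = (iter d (x , y) ≡ (0 , x + y))
              × (∀ k → k < d → ¬ (iter k (x , y) ≡ (0 , x + y)))

module Submission where

-- Both bitwise operations are symmetric, so the map
-- f(X,Y) = (CVT(X,Y), XOR(X,Y)) satisfies f(Y,X) = f(X,Y): a node and its
-- mirror image have the same parent.  Hence f^k(B,A) = f^k(A,B) for every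
-- k ≥ 1, and since A + B = B + A both pairs have the same root (0, A+B).
-- The only step at which the two orbits can differ is k = 0, where neither
-- (A,B) nor (B,A) equals the root because A ≠ 0 and B ≠ 0.  So the least k
-- with f^k(·) = root is the same for both pairs.

open import Defs
open import Data.Nat using (ℕ; zero; suc; _+_; _*_; _<_)
open import Data.Nat.DivMod using (_/_; _%_)
open import Data.Nat.Properties using (+-comm; *-comm)
open import Data.Product using (_×_; _,_; proj₁)
open import Relation.Binary.PropositionalEquality
  using (_≡_; refl; cong; cong₂; module ≡-Reasoning)
open import Relation.Nullary using (¬_)
open import Data.Empty using (⊥-elim)

xorF-comm : ∀ k x y → xorF k x y ≡ xorF k y x
xorF-comm zero    x y = refl
xorF-comm (suc k) x y =
  cong₂ (λ s r → s % 2 + 2 * r) (+-comm (x % 2) (y % 2)) (xorF-comm k (x / 2) (y / 2))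

andF-comm : ∀ k x y → andF k x y ≡ andF k y x
andF-comm zero    x y = refl
andF-comm (suc k) x y =
  cong₂ (λ s r → s + 2 * r) (*-comm (x % 2) (y % 2)) (andF-comm k (x / 2) (y / 2))

XOR-comm : ∀ x y → XOR y x ≡ XOR x y
XOR-comm x y = begin
  xorF (suc (y + x)) y x  ≡⟨ cong (λ n → xorF (suc n) y x) (+-comm y x) ⟩
  xorF (suc (x + y)) y x  ≡⟨ xorF-comm (suc (x + y)) y x ⟩
  xorF (suc (x + y)) x y  ∎
  where open ≡-Reasoning

AND-comm : ∀ x y → AND y x ≡ AND x y
AND-comm x y = begin
  andF (suc (y + x)) y x  ≡⟨ cong (λ n → andF (suc n) y x) (+-comm y x) ⟩
  andF (suc (x + y)) y x  ≡⟨ andF-comm (suc (x + y)) y x ⟩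
  andF (suc (x + y)) x y  ∎
  where open ≡-Reasoning

f-swap : ∀ x y → f (y , x) ≡ f (x , y)
f-swap x y = cong₂ _,_ (cong (2 *_) (AND-comm x y)) (XOR-comm x y)

iter-swap : ∀ k x y → iter (suc k) (y , x) ≡ iter (suc k) (x , y)
iter-swap zero    x y = f-swap x y
iter-swap (suc k) x y = cong f (iter-swap k x y)

reachesRoot-swap : ∀ k x y →
  iter (suc k) (y , x) ≡ (0 , y + x) → iter (suc k) (x , y) ≡ (0 , x + y)
reachesRoot-swap k x y e = begin
  iter (suc k) (x , y)  ≡⟨ iter-swap k y x ⟩
  iter (suc k) (y , x)  ≡⟨ e ⟩
  (0 , y + x)           ≡⟨ cong (0 ,_) (+-comm y x) ⟩
  (0 , x + y)           ∎
  where open ≡-Reasoning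

notRoot : ∀ {x y n : ℕ} → ¬ (x ≡ 0) → ¬ (_≡_ {A = ℕ × ℕ} (x , y) (0 , n))
notRoot x≢0 e = x≢0 (cong proj₁ e)

theorem2 : (N A B d : ℕ) → A + B ≡ N → ¬ (A ≡ 0) → ¬ (B ≡ 0) →
    IsDepth A B d → IsDepth B A d
theorem2 N A B zero    _ A≢0 _   (atRoot , _) = ⊥-elim (notRoot A≢0 atRoot)
theorem2 N A B (suc d) _ _   B≢0 (reaches , minimal) =
  reachesRoot-swap d B A reaches , minimal′
  where
  minimal′ : ∀ k → k < suc d → ¬ (iter k (B , A) ≡ (0 , B + A))
  minimal′ zero    _  = notRoot B≢0
  minimal′ (suc k) k<d e = minimal (suc k) k<d (reachesRoot-swap k A B e)
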